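{- Let $m,M\ge 4$ be integers and let $S= s_1 \cdots s_n$ be a minimal zero-sum sequence over $\llbracket -m,M \rrbracket$ such that at least three elements of $S$ (counted with multiplicity) are different from both $-m$ and $M$. Then there is a permutation $\sigma$ of $\{ 1, \dots , n \}$ such that one of the following holds: (i) for every integer $k$ with $1\leq k \leq n$, $\sum_{i=1}^k s_{\sigma (i)} \in \llbracket -(m-1),M-3 \rrbracket$; (ii) for every integer $k$ with $1\leq k \leq n$, $\sum_{i=1}^k s_{\sigma (i)} \in \llbracket -(m-2),M-2 \rrbracket$; (iii) for every integer $k$ with $1\leq k \leq n$, $\sum_{i=1}^k s_{\sigma (i)} \in \llbracket -(m-3),M-1 \rrbracket$; (iv) the elements of $S$ different from both $-m$ and $M$ are either all in $\{M-1,M-2\}$, or all in $\{ -(m-1),-(m-2)\}$; (v) the elements of $S$ different from both $-m$ and $M$ are all in $\{M-1,-(m-1)\}$; (vi) the elements of $S$ different from both $-m$ and $M$ are either all equal to $M-1$ except possibly one element, or all equal to $-(m-1)$ except possibly one element. In particular, in cases (i), (ii) or (iii), $|S| \leq m+M-3$.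
   Context: A finite sequence of integers $S=s_1\cdots s_n$ is an unordered finite multiset of integers; $|S|=n$ is its length. $S$ is a zero-sum sequence if $\sum_{i=1}^n s_i=0$, and a minimal zero-sum sequence if moreover $\sum_{i\in I}s_i\neq 0$ for every non-empty proper subset $I\subsetneq\{1,\dots,n\}$. A sequence is over a set $A$ if all its elements lie in $A$. For integers $a\le b$, $\llbracket a,b\rrbracket$ denotes the set of integers $i$ with $a\le i\le b$. -}

module Defs where

open import Data.Nat using (ℕ; zero; suc)
open import Data.Integer using (ℤ; +_; _+_; -_; _-_; _≤_)
open import Data.Fin using (Fin; zero; suc)
open import Data.Vec using ([]; _∷_)
open import Data.Bool using (true; false)
open import Data.Fin.Subset using (Subset; Nonempty; ⊤)
open import Data.Product using (_×_; ∃)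
open import Relation.Binary.PropositionalEquality using (_≡_; _≢_)

-- A sequence of length n is an indexed family s : Fin n → ℤ
-- (multiset up to reindexing; index sets I ⊆ {1..n} are Subset n).

⟦_,_⟧ : ℤ → ℤ → ℤ → Set
⟦ a , b ⟧ x = a ≤ x × x ≤ b

sumSeq : (n : ℕ) → (Fin n → ℤ) → ℤ
sumSeq zero s = + 0
sumSeq (suc n) s = s zero + sumSeq n (λ i → s (suc i))

subsetSum : (n : ℕ) → Subset n → (Fin n → ℤ) → ℤ
subsetSum zero [] s = + 0
subsetSum (suc n) (true ∷ I) s = s zero + subsetSum n I (λ i → s (suc i))
subsetSum (suc n) (false ∷ I) s = subsetSum n I (λ i → s (suc i))

prefixSum : (n : ℕ) → (Fin n → ℤ) → ℕ → ℤ
prefixSum zero s k = + 0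
prefixSum (suc n) s zero = + 0
prefixSum (suc n) s (suc k) = s zero + prefixSum n (λ i → s (suc i)) k

IsZeroSum : (n : ℕ) → (Fin n → ℤ) → Set
IsZeroSum n s = sumSeq n s ≡ + 0

IsMinimalZeroSum : (n : ℕ) → (Fin n → ℤ) → Set
IsMinimalZeroSum n s =
  IsZeroSum n s × (∀ (I : Subset n) → Nonempty I → I ≢ ⊤ → subsetSum n I s ≢ + 0)

IsOver : (n : ℕ) → (Fin n → ℤ) → (ℤ → Set) → Set
IsOver n s A = ∀ i → A (s i)

{-# OPTIONS --safe #-}
-- The partial sums of a minimal zero-sum sequence are pairwise distinct, since two equal ones would cut out a proper
-- zero-sum block; so when they all lie in a window of width m + M − 3, there are at most m + M − 3 of them.
--
-- For the classification, order S greedily keeping every partial sum in W = ⟦ −(m−2), M−2 ⟧. From a sum c ≤ −2 any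
-- positive term may follow, from c ≥ 2 any negative one; only the sums ∓1 need a middle term of the right size. By
-- minimality each of ∓1 is reached at most once, so it suffices to hold one suitable term in reserve for each visit
-- and to use M and −m elsewhere whenever possible. When all middle terms are negative the two visits compete for
-- them and a finer reserve is kept. If no middle term can start such a walk, the middle terms are forced into one of
-- the shapes (iv)–(vi). Negating S and swapping m and M reduces mostly positive middle terms to mostly negative ones.
module Submission where

open import Defs
open import Data.Nat using (ℕ; suc)
open import Data.Nat as ℕ using ()
open import Data.Integer using (ℤ; +_; _+_; -_; _-_; _≤_)
open import Data.Fin using (Fin)
open import Data.Fin.Permutation using (Permutation′; _⟨$⟩ʳ_)
open import Data.Product using (_×_; ∃; Σ)
open import Data.Sum using (_⊎_)
open import Relation.Binary.PropositionalEquality using (_≡_; _≢_)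

open import Data.Bool using (Bool; true; false; if_then_else_)
open import Data.Bool.Properties using (not-¬)
open import Data.Empty using (⊥; ⊥-elim)
open import Data.Fin using (zero; suc; punchIn; punchOut; toℕ; fromℕ<)
import Data.Fin.Properties as FinP
open import Data.Fin.Permutation using (_⟨$⟩ˡ_; inverseˡ; insert; insert-punchIn)
import Data.Fin.Permutation as Perm
open import Data.Integer using (_<_; +≤+; -≤-; -≤+; +<+; -<+; ∣_∣; -[1+_])
import Data.Integer.Properties as ℤP
open import Data.Integer.Tactic.RingSolver using (solve-∀)
open import Data.Nat using (zero; z≤n; s≤s)
import Data.Nat.Properties as ℕP
open import Data.Product using (_,_; proj₁; proj₂; ∃₂)
open import Data.Sum using (inj₁; inj₂; [_,_]′; reduce)
import Data.Sum as Sum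
import Data.Vec as Vec
import Data.Vec.Properties as VecP
open import Data.Vec.Functional using (Vector; _∷_; removeAt; insertAt)
import Data.Vec.Functional.Properties as VFP
open import Data.Vec.Functional.Relation.Unary.All using (All)
open import Data.Vec.Functional.Relation.Unary.Any using (Any; any)
open import Function using (_∘_; id)
open import Function.Definitions using (Injective)
open import Relation.Binary.Definitions using (tri<; tri≈; tri>)
open import Relation.Binary.PropositionalEquality
  using (refl; sym; trans; cong; cong₂; subst; subst₂; module ≡-Reasoning)
open import Relation.Nullary using (¬_; Dec; yes; no)
open import Relation.Nullary.Decidable using (_×-dec_; ¬?)
open import Relation.Unary using (Decidable)

open import Algebra.Properties.CommutativeMonoid.Sum ℤP.+-0-commutativeMonoid
  using (sum; sum-remove; sum-permute; sum-cong-≗; sum-replicate-zero)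
open import Algebra.Properties.AbelianGroup ℤP.+-0-abelianGroup using (∙-cancelˡ; ∙-cancelʳ)

private
  variable
    k n : ℕ
    a b c d a′ b′ v x y : ℤ
    P Q : ℤ → Set

subsum : Vector Bool k → Vector ℤ k → ℤ
subsum I t = sum (λ x → if I x then t x else + 0)

sumSeq≡sum : ∀ n (s : Vector ℤ n) → sumSeq n s ≡ sum s
sumSeq≡sum zero s = refl
sumSeq≡sum (suc n) s = cong (λ y → s zero + y) (sumSeq≡sum n (s ∘ suc))

subsetSum≡subsum : ∀ n (I : Vector Bool n) (s : Vector ℤ n) → subsetSum n (Vec.tabulate I) s ≡ subsum I s
subsetSum≡subsum zero I s = refl
subsetSum≡subsum (suc n) I s with I zero
... | true = cong (λ y → s zero + y) (subsetSum≡subsum n (I ∘ suc) (s ∘ suc))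
... | false = trans (subsetSum≡subsum n (I ∘ suc) (s ∘ suc)) (sym (ℤP.+-identityˡ _))

subsum-∅ : (t : Vector ℤ k) → subsum (λ _ → false) t ≡ + 0
subsum-∅ {k} t = sum-replicate-zero k

subsum-insertAt : (I : Vector Bool k) (t : Vector ℤ (suc k)) (j : Fin (suc k)) (β : Bool) →
  subsum (insertAt I j β) t ≡ (if β then t j else + 0) + subsum I (removeAt t j)
subsum-insertAt I t j β = trans (sum-remove {i = j} (λ x → if insertAt I j β x then t x else + 0)) (cong₂ _+_
  (cong (λ γ → if γ then t j else + 0) (VFP.insertAt-lookup I j β))
  (sum-cong-≗ λ x → cong (λ γ → if γ then t (punchIn j x) else + 0) (VFP.insertAt-punchIn I j β x)))

sum-neg : (t : Vector ℤ k) → sum (-_ ∘ t) ≡ - sum t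
sum-neg {zero} t = refl
sum-neg {suc k} t = trans (cong (λ y → - t zero + y) (sum-neg (t ∘ suc))) (sym (ℤP.neg-distrib-+ (t zero) _))

subsum-neg : (I : Vector Bool k) (t : Vector ℤ k) → subsum I (-_ ∘ t) ≡ - subsum I t
subsum-neg I t = trans (sum-cong-≗ λ x → select-neg (I x)) (sum-neg (λ x → if I x then t x else + 0))
  where
  select-neg : ∀ β {x} → (if β then - x else + 0) ≡ - (if β then x else + 0)
  select-neg true = refl
  select-neg false = refl

subsum-permute : (I : Vector Bool k) (t : Vector ℤ k) (σ : Permutation′ k) →
  subsum I (t ∘ (σ ⟨$⟩ʳ_)) ≡ subsum (I ∘ (σ ⟨$⟩ˡ_)) t
subsum-permute I t σ = sym (trans (sum-permute _ σ)
  (sum-cong-≗ λ x → cong (λ γ → if γ then t (σ ⟨$⟩ʳ x) else + 0) (cong I (inverseˡ σ))))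

sum-nonneg : (t : Vector ℤ k) → All (λ x → + 0 ≤ x) t → + 0 ≤ sum t
sum-nonneg {zero} t _ = ℤP.≤-refl
sum-nonneg {suc k} t t≥0 = ℤP.+-mono-≤ (t≥0 zero) (sum-nonneg (t ∘ suc) (t≥0 ∘ suc))

term≤sum : (t : Vector ℤ (suc k)) → All (λ x → + 0 ≤ x) t → ∀ j → t j ≤ sum t
term≤sum t t≥0 j = begin
  t j                        ≡⟨ sym (ℤP.+-identityʳ (t j)) ⟩
  t j + + 0                  ≤⟨ ℤP.+-monoʳ-≤ (t j) (sum-nonneg (removeAt t j) (t≥0 ∘ punchIn j)) ⟩
  t j + sum (removeAt t j)   ≡⟨ sym (sum-remove t) ⟩
  sum t                      ∎
  where open ℤP.≤-Reasoning

∃-neg : (t : Vector ℤ k) → sum t < + 0 → Any (_< + 0) t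
∃-neg t sum<0 with any (λ x → x ℤP.<? + 0) t
... | yes found = found
... | no none = ⊥-elim (ℤP.<⇒≱ sum<0 (sum-nonneg t λ x → ℤP.≮⇒≥ (none ∘ (x ,_))))

∃-pos : (t : Vector ℤ k) → + 0 < sum t → Any (λ x → + 0 < x) t
∃-pos t 0<sum with ∃-neg (-_ ∘ t) (subst (_< + 0) (sym (sum-neg t)) (ℤP.neg-mono-< 0<sum))
... | x , -tx<0 = x , ℤP.neg-cancel-< -tx<0

prefixSum-zero : ∀ n (t : Vector ℤ n) → prefixSum n t 0 ≡ + 0
prefixSum-zero zero t = refl
prefixSum-zero (suc n) t = refl

prefixSum-cong : ∀ n {t t′ : Vector ℤ n} → (∀ x → t x ≡ t′ x) → ∀ K → prefixSum n t K ≡ prefixSum n t′ K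
prefixSum-cong zero t≗t′ K = refl
prefixSum-cong (suc n) t≗t′ zero = refl
prefixSum-cong (suc n) t≗t′ (suc K) = cong₂ _+_ (t≗t′ zero) (prefixSum-cong n (t≗t′ ∘ suc) K)

prefixSum≡subsum : ∀ n (t : Vector ℤ n) K → prefixSum n t K ≡ subsum (λ x → toℕ x ℕ.<ᵇ K) t
prefixSum≡subsum zero t K = refl
prefixSum≡subsum (suc n) t zero = sym (subsum-∅ t)
prefixSum≡subsum (suc n) t (suc K) = cong (λ y → t zero + y) (prefixSum≡subsum n (t ∘ suc) K)

prefixSum-neg : ∀ n (t : Vector ℤ n) K → prefixSum n (-_ ∘ t) K ≡ - prefixSum n t K
prefixSum-neg zero t K = refl
prefixSum-neg (suc n) t zero = refl
prefixSum-neg (suc n) t (suc K) =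
  trans (cong (λ y → - t zero + y) (prefixSum-neg n (t ∘ suc) K)) (sym (ℤP.neg-distrib-+ (t zero) _))

⟦⟧? : ∀ a b → Decidable ⟦ a , b ⟧
⟦⟧? a b x = (a ℤP.≤? x) ×-dec (x ℤP.≤? b)

⟦⟧-refl : ⟦ x , x ⟧ x
⟦⟧-refl = ℤP.≤-refl , ℤP.≤-refl

⟦⟧-point : ⟦ a , a ⟧ x → x ≡ a
⟦⟧-point (a≤x , x≤a) = ℤP.≤-antisym x≤a a≤x

⟦⟧-widen : a′ ≤ a → b ≤ b′ → ⟦ a , b ⟧ x → ⟦ a′ , b′ ⟧ x
⟦⟧-widen a′≤a b≤b′ (a≤x , x≤b) = ℤP.≤-trans a′≤a a≤x , ℤP.≤-trans x≤b b≤b′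

⟦⟧-+ : ⟦ a , b ⟧ x → ⟦ c , d ⟧ y → ⟦ a + c , b + d ⟧ (x + y)
⟦⟧-+ (a≤x , x≤b) (c≤y , y≤d) = ℤP.+-mono-≤ a≤x c≤y , ℤP.+-mono-≤ x≤b y≤d

⟦⟧-neg : ⟦ a , b ⟧ x → ⟦ - b , - a ⟧ (- x)
⟦⟧-neg (a≤x , x≤b) = ℤP.neg-mono-≤ x≤b , ℤP.neg-mono-≤ a≤x

⟦⟧-neg⁻ : ⟦ - b , a ⟧ (- x) → ⟦ - a , b ⟧ x
⟦⟧-neg⁻ {x = x} (-b≤-x , -x≤a) =
  subst (λ y → _ ≤ y) (ℤP.neg-involutive x) (ℤP.neg-mono-≤ -x≤a) , ℤP.neg-cancel-≤ -b≤-x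

⟦⟧-split : ∀ c → ⟦ a , b ⟧ x → ⟦ a , c ⟧ x ⊎ ⟦ + 1 + c , b ⟧ x
⟦⟧-split {x = x} c (a≤x , x≤b) with x ℤP.≤? c
... | yes x≤c = inj₁ (a≤x , x≤c)
... | no x≰c = inj₂ (ℤP.i<j⇒suc[i]≤j (ℤP.≰⇒> x≰c) , x≤b)

⟦⟧-disjoint : ⟦ a , b ⟧ x → ⟦ c , d ⟧ x → b < c → ⊥
⟦⟧-disjoint (_ , x≤b) (c≤x , _) b<c = ℤP.<⇒≱ (ℤP.≤-<-trans x≤b b<c) c≤x

nonzero-cases : x ≢ + 0 → x ≤ - + 2 ⊎ x ≡ - + 1 ⊎ x ≡ + 1 ⊎ + 2 ≤ x
nonzero-cases {+ zero} x≢0 = ⊥-elim (x≢0 refl)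
nonzero-cases {+ suc zero} _ = inj₂ (inj₂ (inj₁ refl))
nonzero-cases {+ suc (suc n)} _ = inj₂ (inj₂ (inj₂ (+≤+ (s≤s (s≤s z≤n)))))
nonzero-cases { -[1+ zero ]} _ = inj₂ (inj₁ refl)
nonzero-cases { -[1+ suc n ]} _ = inj₁ (-≤- (s≤s z≤n))

injective⇒≤-width : (f : Fin (suc n) → ℤ) → Injective _≡_ _≡_ f → (∀ x → ⟦ a , b ⟧ (f x)) →
  + suc n ≤ b - a + + 1
injective⇒≤-width {n} {a} {b} f f-inj f∈ =
  ℤP.≤-trans (+≤+ (FinP.injective⇒≤ h-inj))
    (ℤP.≤-reflexive (trans (cong +_ (ℕP.+-comm 1 L)) (cong (λ w → w + + 1) width≡)))
  where
  L = ∣ b - a ∣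
  width≡ : + L ≡ b - a
  width≡ = ℤP.0≤i⇒+∣i∣≡i (ℤP.i≤j⇒0≤j-i (ℤP.≤-trans (proj₁ (f∈ zero)) (proj₂ (f∈ zero))))
  offset : Fin (suc n) → ℕ
  offset x = ∣ f x - a ∣
  offset≡ : ∀ x → + offset x ≡ f x - a
  offset≡ x = ℤP.0≤i⇒+∣i∣≡i (ℤP.i≤j⇒0≤j-i (proj₁ (f∈ x)))
  offset≤L : ∀ x → offset x ℕ.≤ L
  offset≤L x = ℤP.drop‿+≤+ (subst₂ _≤_ (sym (offset≡ x)) (sym width≡) (ℤP.+-monoˡ-≤ (- a) (proj₂ (f∈ x))))
  h : Fin (suc n) → Fin (suc L)
  h x = fromℕ< (s≤s (offset≤L x))
  h-inj : Injective _≡_ _≡_ h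
  h-inj {x} {y} hx≡hy = f-inj (∙-cancelʳ (- a) (f x) (f y)
    (trans (sym (offset≡ x)) (trans (cong +_ offset-eq) (offset≡ y))))
    where
    offset-eq = trans (sym (FinP.toℕ-fromℕ< _)) (trans (cong toℕ hx≡hy) (FinP.toℕ-fromℕ< _))

Any-removeAt : (r : Vector ℤ (suc k)) {x : Fin (suc k)} → P (r x) → ∀ {j} → j ≢ x → Any P (removeAt r j)
Any-removeAt {P = P} r p j≢x = punchOut j≢x , subst P (sym (VFP.removeAt-punchOut r j≢x)) p

Any-removeAt-¬ : (r : Vector ℤ (suc k)) → Any P r → ∀ {j} → ¬ P (r j) → Any P (removeAt r j)
Any-removeAt-¬ {P = P} r (x , p) ¬pj = Any-removeAt {P = P} r p λ j≡x → ¬pj (subst (P ∘ r) (sym j≡x) p)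

¬Any-removeAt : (r : Vector ℤ (suc k)) → ¬ Any P r → ∀ j → All (λ x → ¬ P x) (removeAt r j)
¬Any-removeAt r none j x = none ∘ (punchIn j x ,_)

any-or-none : Decidable Q → (r : Vector ℤ k) → All (λ x → P x → Q x) r → Any Q r ⊎ All (λ x → ¬ P x) r
any-or-none Q? r P⇒Q with any Q? r
... | yes found = inj₁ found
... | no none = inj₂ λ x px → none (x , P⇒Q x px)

Two : (P Q : ℤ → Set) → Vector ℤ k → Set
Two P Q r = ∃₂ λ x y → x ≢ y × P (r x) × Q (r y)

Two? : Decidable P → Decidable Q → (r : Vector ℤ k) → Dec (Two P Q r)
Two? P? Q? r = FinP.any? λ x → FinP.any? λ y → ¬? (x FinP.≟ y) ×-dec (P? (r x) ×-dec Q? (r y))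

Two-removeAt : (r : Vector ℤ (suc k)) {x y : Fin (suc k)} → x ≢ y → P (r x) → Q (r y) →
  ∀ {j} → j ≢ x → j ≢ y → Two P Q (removeAt r j)
Two-removeAt {P = P} {Q = Q} r x≢y p q j≢x j≢y =
  punchOut j≢x , punchOut j≢y , x≢y ∘ FinP.punchOut-injective j≢x j≢y ,
  subst P (sym (VFP.removeAt-punchOut r j≢x)) p , subst Q (sym (VFP.removeAt-punchOut r j≢y)) q

Two-removeAt-¬ : (r : Vector ℤ (suc k)) → Two P Q r → ∀ {j} → ¬ P (r j) → ¬ Q (r j) → Two P Q (removeAt r j)
Two-removeAt-¬ {P = P} {Q = Q} r (x , y , x≢y , p , q) ¬pj ¬qj =
  Two-removeAt {P = P} {Q = Q} r x≢y p q
    (λ j≡x → ¬pj (subst (P ∘ r) (sym j≡x) p)) (λ j≡y → ¬qj (subst (Q ∘ r) (sym j≡y) q))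

Two⇒Any-removeAt : (r : Vector ℤ (suc k)) → Two P Q r → ∀ j → Any P (removeAt r j) ⊎ Any Q (removeAt r j)
Two⇒Any-removeAt {P = P} {Q = Q} r (x , y , x≢y , p , q) j with j FinP.≟ x
... | yes refl = inj₂ (Any-removeAt {P = Q} r q x≢y)
... | no j≢x = inj₁ (Any-removeAt {P = P} r p j≢x)

Three : (P : ℤ → Set) → Vector ℤ k → Set
Three P s = ∃ λ i → ∃ λ j → ∃ λ k → i ≢ j × i ≢ k × j ≢ k × P (s i) × P (s j) × P (s k)

Three-map : {s t : Vector ℤ k} → (∀ i → P (s i) → Q (t i)) → Three P s → Three Q t
Three-map f (i , j , k , i≢j , i≢k , j≢k , pi , pj , pk) = i , j , k , i≢j , i≢k , j≢k , f i pi , f j pj , f k pk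

Three⇒Two : {s : Vector ℤ k} → Three (λ x → P x ⊎ Q x) s → Two P P s ⊎ Two Q Q s
Three⇒Two {P = P} {Q = Q} {s = s} (i , j , k , i≢j , i≢k , j≢k , pi , pj , pk) = pigeonhole pi pj pk
  where
  pigeonhole : P (s i) ⊎ Q (s i) → P (s j) ⊎ Q (s j) → P (s k) ⊎ Q (s k) → Two P P s ⊎ Two Q Q s
  pigeonhole (inj₁ p) (inj₁ p′) _ = inj₁ (i , j , i≢j , p , p′)
  pigeonhole (inj₂ q) (inj₂ q′) _ = inj₂ (i , j , i≢j , q , q′)
  pigeonhole (inj₁ p) (inj₂ _) (inj₁ p′) = inj₁ (i , k , i≢k , p , p′)
  pigeonhole (inj₂ q) (inj₁ _) (inj₂ q′) = inj₂ (i , k , i≢k , q , q′)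
  pigeonhole (inj₁ _) (inj₂ q) (inj₂ q′) = inj₂ (j , k , j≢k , q , q′)
  pigeonhole (inj₂ _) (inj₁ p) (inj₁ p′) = inj₁ (j , k , j≢k , p , p′)

Three⇒avoiding : {s : Vector ℤ k} → Three P s → ∀ a b → ∃ λ x → x ≢ a × x ≢ b × P (s x)
Three⇒avoiding {P = P} {s = s} (i , j , k , i≢j , i≢k , j≢k , pi , pj , pk) a b with pair
  where
  pair : ∃₂ λ x y → x ≢ y × x ≢ a × y ≢ a × P (s x) × P (s y)
  pair with i FinP.≟ a | j FinP.≟ a
  ... | yes refl | _ = j , k , j≢k , i≢j ∘ sym , i≢k ∘ sym , pj , pk
  ... | no i≢a | yes refl = i , k , i≢k , i≢a , j≢k ∘ sym , pi , pk
  ... | no i≢a | no j≢a = i , j , i≢j , i≢a , j≢a , pi , pj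
... | x , y , x≢y , x≢a , y≢a , px , py with x FinP.≟ b
...   | yes refl = y , y≢a , x≢y ∘ sym , py
...   | no x≢b = x , x≢a , x≢b , px

-- Minimal zero-sum sequences

record IsMinimal (t : Vector ℤ k) : Set where
  constructor isMinimal
  field
    sum≡0 : sum t ≡ + 0
    proper-subsum≢0 : ∀ I → Any (_≡ true) I → Any (_≡ false) I → subsum I t ≢ + 0

isMinimalZeroSum⇒IsMinimal : ∀ n (s : Vector ℤ n) → IsMinimalZeroSum n s → IsMinimal s
isMinimalZeroSum⇒IsMinimal n s (zero-sum , minimal) = isMinimal (trans (sym (sumSeq≡sum n s)) zero-sum) proper≢0
  where
  proper≢0 : ∀ I → Any (_≡ true) I → Any (_≡ false) I → subsum I s ≢ + 0
  proper≢0 I (x , Ix) (y , Iy) I-sum = minimal (Vec.tabulate I)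
    (x , VecP.lookup⇒[]= x _ (trans (VecP.lookup∘tabulate I x) Ix))
    (λ I≡⊤ → not-¬ Iy (trans (sym (VecP.lookup∘tabulate I y))
      (trans (cong (λ p → Vec.lookup p y) I≡⊤) (VecP.lookup-replicate y true))))
    (trans (subsetSum≡subsum n I s) I-sum)

IsMinimal-transfer : {t : Vector ℤ k} {t′ : Vector ℤ n} (lift : Vector Bool n → Vector Bool k) →
  (∀ {β} I → Any (_≡ β) I → Any (_≡ β) (lift I)) →
  (∀ I → subsum I t′ ≡ + 0 → subsum (lift I) t ≡ + 0) →
  sum t′ ≡ + 0 → IsMinimal t → IsMinimal t′
IsMinimal-transfer lift lift-Any lift-zero zero-sum (isMinimal _ minimal) =
  isMinimal zero-sum λ I nonempty proper → minimal (lift I) (lift-Any I nonempty) (lift-Any I proper) ∘ lift-zero I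

IsMinimal-merge : (r : Vector ℤ (suc k)) → IsMinimal (c ∷ r) → ∀ j → IsMinimal ((c + r j) ∷ removeAt r j)
IsMinimal-merge {c = c} r min@(isMinimal zero-sum _) j = IsMinimal-transfer lift lift-Any
  (λ I → trans (lift-subsum I))
  (trans (ℤP.+-assoc c (r j) _) (trans (cong (λ y → c + y) (sym (sum-remove r))) zero-sum)) min
  where
  lift : Vector Bool (suc _) → Vector Bool (suc (suc _))
  lift I = I zero ∷ insertAt (I ∘ suc) j (I zero)
  lift-Any : ∀ {β} I → Any (_≡ β) I → Any (_≡ β) (lift I)
  lift-Any I (zero , e) = zero , e
  lift-Any I (suc x , e) = suc (punchIn j x) , trans (VFP.insertAt-punchIn (I ∘ suc) j (I zero) x) e
  select-+ : ∀ β {x y} → (if β then x else + 0) + (if β then y else + 0) ≡ (if β then x + y else + 0)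
  select-+ true = refl
  select-+ false = refl
  lift-subsum : ∀ I → subsum (lift I) (c ∷ r) ≡ subsum I ((c + r j) ∷ removeAt r j)
  lift-subsum I = begin
    ĉ + subsum (insertAt J j (I zero)) r      ≡⟨ cong (λ y → ĉ + y) (subsum-insertAt J r j (I zero)) ⟩
    ĉ + (r̂ + subsum J (removeAt r j))        ≡⟨ sym (ℤP.+-assoc ĉ r̂ _) ⟩
    ĉ + r̂ + subsum J (removeAt r j)          ≡⟨ cong (λ y → y + subsum J (removeAt r j)) (select-+ (I zero)) ⟩
    (if I zero then c + r j else + 0) + subsum J (removeAt r j) ∎
    where
    open ≡-Reasoning
    J = I ∘ suc
    ĉ = if I zero then c else + 0
    r̂ = if I zero then r j else + 0

IsMinimal-moveToFront : (t : Vector ℤ (suc k)) → IsMinimal t → ∀ j → IsMinimal (t j ∷ removeAt t j)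
IsMinimal-moveToFront t min@(isMinimal zero-sum _) j = IsMinimal-transfer lift lift-Any
  (λ I → trans (subsum-insertAt (I ∘ suc) t j (I zero))) (trans (sym (sum-remove t)) zero-sum) min
  where
  lift : Vector Bool (suc _) → Vector Bool (suc _)
  lift I = insertAt (I ∘ suc) j (I zero)
  lift-Any : ∀ {β} I → Any (_≡ β) I → Any (_≡ β) (lift I)
  lift-Any I (zero , e) = j , trans (VFP.insertAt-lookup (I ∘ suc) j (I zero)) e
  lift-Any I (suc x , e) = punchIn j x , trans (VFP.insertAt-punchIn (I ∘ suc) j (I zero) x) e

IsMinimal-permute : (t : Vector ℤ k) → IsMinimal t → (σ : Permutation′ k) → IsMinimal (t ∘ (σ ⟨$⟩ʳ_))
IsMinimal-permute t min@(isMinimal zero-sum _) σ = IsMinimal-transfer (_∘ (σ ⟨$⟩ˡ_))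
  (λ I (x , e) → σ ⟨$⟩ʳ x , trans (cong I (inverseˡ σ)) e)
  (λ I → trans (sym (subsum-permute I t σ))) (trans (sym (sum-permute t σ)) zero-sum) min

IsMinimal-neg : (t : Vector ℤ k) → IsMinimal t → IsMinimal (-_ ∘ t)
IsMinimal-neg t min@(isMinimal zero-sum _) = IsMinimal-transfer (λ I → I) (λ I any → any)
  (λ I e → ℤP.neg-injective (trans (sym (subsum-neg I t)) e)) (trans (sum-neg t) (cong -_ zero-sum)) min

IsMinimal⇒nonzero : (t : Vector ℤ (suc k)) → IsMinimal t → ∀ {i j} → i ≢ j → All (_≢ + 0) t
IsMinimal⇒nonzero t (isMinimal _ minimal) {i} {j} i≢j x tx≡0 = minimal singleton
  (x , VFP.insertAt-lookup _ x true)
  (x′ , trans (cong singleton (sym (FinP.punchIn-punchOut x≢x′))) (VFP.insertAt-punchIn _ x true (punchOut x≢x′)))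
  (trans (subsum-insertAt _ t x true) (cong₂ _+_ tx≡0 (subsum-∅ (removeAt t x))))
  where
  singleton = insertAt (λ _ → false) x true
  other : ∃ λ x′ → x ≢ x′
  other with x FinP.≟ i
  ... | yes refl = j , i≢j
  ... | no x≢i = i , x≢i
  x′ = proj₁ other
  x≢x′ = proj₂ other

sum-tail≡-head : (r : Vector ℤ k) → IsMinimal (c ∷ r) → sum r ≡ - c
sum-tail≡-head {c = c} r (isMinimal zero-sum _) = ∙-cancelˡ c _ _ (trans zero-sum (sym (ℤP.+-inverseʳ c)))

prefixSum-≢0 : (r : Vector ℤ (suc k)) → IsMinimal (c ∷ r) → ∀ K → prefixSum (suc k) r (suc K) ≢ + 0
prefixSum-≢0 r (isMinimal _ minimal) K P≡0 = minimal (false ∷ initial) (suc zero , refl) (zero , refl)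
  (trans (ℤP.+-identityˡ _) (trans (sym (prefixSum≡subsum _ r (suc K))) P≡0))
  where
  initial = λ x → toℕ x ℕ.<ᵇ suc K

partialSums-distinct : (r : Vector ℤ k) → IsMinimal (c ∷ r) → ∀ {i j} → i ℕ.< j → j ℕ.≤ k →
  c + prefixSum k r i ≢ c + prefixSum k r j
partialSums-distinct {suc k} {c} r min {zero} {suc j} _ _ eq = prefixSum-≢0 r min j (sym (∙-cancelˡ c _ _ eq))
partialSums-distinct {suc k} {c} r min {suc i} {suc j} (s≤s i<j) (s≤s j≤k) eq =
  partialSums-distinct (removeAt r zero) (IsMinimal-merge r min zero) i<j j≤k
    (trans (ℤP.+-assoc c (r zero) _) (trans eq (sym (ℤP.+-assoc c (r zero) _))))

partialSums-injective : (r : Vector ℤ k) → IsMinimal (c ∷ r) →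
  Injective _≡_ _≡_ (λ (i : Fin (suc k)) → c + prefixSum k r (toℕ i))
partialSums-injective r min {x} {y} eq with ℕP.<-cmp (toℕ x) (toℕ y)
... | tri< x<y _ _ = ⊥-elim (partialSums-distinct r min x<y (FinP.toℕ≤pred[n] y) eq)
... | tri≈ _ x≡y _ = FinP.toℕ-injective x≡y
... | tri> _ _ y<x = ⊥-elim (partialSums-distinct r min y<x (FinP.toℕ≤pred[n] x) (sym eq))

window⇒length≤ : (t : Vector ℤ (suc n)) → IsMinimal t →
  (∀ K → 1 ℕ.≤ K → K ℕ.≤ suc n → ⟦ a , b ⟧ (prefixSum (suc n) t K)) → + suc n ≤ b - a + + 1
window⇒length≤ t min window = injective⇒≤-width _
  (partialSums-injective (removeAt t zero) (IsMinimal-moveToFront t min zero))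
  (λ x → window (suc (toℕ x)) (s≤s z≤n) (s≤s (FinP.toℕ≤pred[n] x)))

Avoids : ℤ → ℤ → Vector ℤ k → Set
Avoids v c r = ∀ I → c + subsum I r ≢ v

Avoids⇒≢ : (r : Vector ℤ k) → Avoids v c r → c ≢ v
Avoids⇒≢ {c = c} r avoids c≡v =
  avoids (λ _ → false) (trans (cong (λ y → c + y) (subsum-∅ r)) (trans (ℤP.+-identityʳ c) c≡v))

Avoids-removeAt : (r : Vector ℤ (suc k)) → Avoids v c r → ∀ j → Avoids v (c + r j) (removeAt r j)
Avoids-removeAt {c = c} r avoids j I eq = avoids (insertAt I j true)
  (trans (cong (λ y → c + y) (subsum-insertAt I r j true)) (trans (sym (ℤP.+-assoc c (r j) _)) eq))

-- A return to v would close up a proper zero-sum subsequence of v ∷ r.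
IsMinimal⇒Avoids : (r : Vector ℤ (suc k)) → IsMinimal (v ∷ r) → ∀ j → Avoids v (v + r j) (removeAt r j)
IsMinimal⇒Avoids {v = v} r (isMinimal _ minimal) j I eq = minimal (false ∷ insertAt I j true)
  (suc j , VFP.insertAt-lookup I j true) (zero , refl)
  (trans (ℤP.+-identityˡ _) (trans (subsum-insertAt I r j true)
    (∙-cancelˡ v _ _ (trans (sym (ℤP.+-assoc v (r j) _)) (trans eq (sym (ℤP.+-identityʳ v)))))))

-- Walks

record Walk (W : ℤ → Set) (c : ℤ) (r : Vector ℤ k) : Set where
  constructor walkAlong
  field
    order : Permutation′ k
    stays : ∀ K → 1 ℕ.≤ K → K ℕ.≤ k → W (c + prefixSum k (r ∘ (order ⟨$⟩ʳ_)) K)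

Good : (W : ℤ → Set) → Vector ℤ k → Set
Good {k} W s = Σ (Permutation′ k) λ σ → ∀ K → 1 ℕ.≤ K → K ℕ.≤ k → W (prefixSum k (s ∘ (σ ⟨$⟩ʳ_)) K)

module _ {W : ℤ → Set} where

  walk-[] : (r : Vector ℤ 0) → Walk W c r
  walk-[] r = walkAlong Perm.id λ { (suc K) _ () }

  walk-∷ : (r : Vector ℤ (suc k)) → ∀ j → W (c + r j) → Walk W (c + r j) (removeAt r j) → Walk W c r
  walk-∷ {k} {c} r j w (walkAlong τ τ-ok) = walkAlong σ σ-ok
    where
    σ = insert zero j τ
    rest : ∀ K → prefixSum k (removeAt r j ∘ (τ ⟨$⟩ʳ_)) K ≡ prefixSum k (r ∘ (σ ⟨$⟩ʳ_) ∘ suc) K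
    rest = prefixSum-cong k λ i → cong r (sym (insert-punchIn zero j τ i))
    σ-ok : ∀ K → 1 ℕ.≤ K → K ℕ.≤ suc k → W (c + prefixSum (suc k) (r ∘ (σ ⟨$⟩ʳ_)) K)
    σ-ok (suc zero) _ _ =
      subst W (cong (λ y → c + (r j + y)) (sym (prefixSum-zero k _)))
        (subst W (cong (λ y → c + y) (sym (ℤP.+-identityʳ (r j)))) w)
    σ-ok (suc (suc K)) _ (s≤s K<k) =
      subst W (trans (ℤP.+-assoc c (r j) _) (cong (λ y → c + (r j + y)) (rest (suc K))))
        (τ-ok (suc K) (s≤s z≤n) K<k)

  walk-start : (s : Vector ℤ (suc k)) → ∀ j → W (s j) → Walk W (s j) (removeAt s j) → Good W s
  walk-start s j w walk with walk-∷ {c = + 0} s j (subst W (sym (ℤP.+-identityˡ (s j))) w)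
                               (subst (λ c → Walk W c (removeAt s j)) (sym (ℤP.+-identityˡ (s j))) walk)
  ... | walkAlong σ σ-ok = σ , λ K 1≤K K≤k → subst W (ℤP.+-identityˡ _) (σ-ok K 1≤K K≤k)

module Window (m M : ℤ) (4≤m : + 4 ≤ m) (4≤M : + 4 ≤ M) where

  W Pos Neg MidPos MidNeg LargeNeg SmallNeg : ℤ → Set
  W = ⟦ - (m - + 2) , M - + 2 ⟧
  Pos = ⟦ + 1 , M ⟧
  Neg = ⟦ - m , - + 1 ⟧
  MidPos = ⟦ + 1 , M - + 1 ⟧
  MidNeg = ⟦ - (m - + 1) , - + 1 ⟧
  LargeNeg = ⟦ - (m - + 1) , - (m - + 2) ⟧
  SmallNeg = ⟦ - (m - + 3) , - + 1 ⟧

  Over : Vector ℤ k → Set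
  Over {k} r = IsOver k r ⟦ - m , M ⟧

  private
    2≤m-2 : + 2 ≤ m - + 2
    2≤m-2 = ℤP.+-monoˡ-≤ (- + 2) 4≤m
    2≤M-2 : + 2 ≤ M - + 2
    2≤M-2 = ℤP.+-monoˡ-≤ (- + 2) 4≤M
    -[m-2]≤-1 : - (m - + 2) ≤ - + 1
    -[m-2]≤-1 = ℤP.neg-mono-≤ (ℤP.≤-trans (+≤+ (s≤s z≤n)) 2≤m-2)
    -[m-2]≤0 : - (m - + 2) ≤ + 0
    -[m-2]≤0 = ℤP.≤-trans -[m-2]≤-1 -≤+
    0≤M-2 : + 0 ≤ M - + 2
    0≤M-2 = ℤP.≤-trans (+≤+ z≤n) 2≤M-2
    1≤M-1 : + 1 ≤ M - + 1
    1≤M-1 = ℤP.≤-trans (+≤+ (s≤s z≤n)) (ℤP.+-monoˡ-≤ (- + 1) 4≤M)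
    -m≤-[m-1] : - m ≤ - (m - + 1)
    -m≤-[m-1] = ℤP.neg-mono-≤ (ℤP.i-j≤i m (+ 1))
    1+[x-1]≡x : ∀ x → + 1 + (x - + 1) ≡ x
    1+[x-1]≡x = solve-∀
    1+-x≡-[x-1] : ∀ x → + 1 + - x ≡ - (x - + 1)
    1+-x≡-[x-1] = solve-∀
    1+-[x-1]≡-[x-2] : ∀ x → + 1 + - (x - + 1) ≡ - (x - + 2)
    1+-[x-1]≡-[x-2] = solve-∀
    1+-[x-2]≡-[x-3] : ∀ x → + 1 + - (x - + 2) ≡ - (x - + 3)
    1+-[x-2]≡-[x-3] = solve-∀
    1+[x-2]≡x-1 : ∀ x → + 1 + (x - + 2) ≡ x - + 1
    1+[x-2]≡x-1 = solve-∀
    2+-x≡-[x-2] : ∀ x → + 2 + - x ≡ - (x - + 2)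
    2+-x≡-[x-2] = solve-∀
    -1+[x-1]≡x-2 : ∀ x → - + 1 + (x - + 1) ≡ x - + 2
    -1+[x-1]≡x-2 = solve-∀
    -1+-[x-3]≡-[x-2] : ∀ x → - + 1 + - (x - + 3) ≡ - (x - + 2)
    -1+-[x-3]≡-[x-2] = solve-∀

  W? : Decidable W
  W? = ⟦⟧? (- (m - + 2)) (M - + 2)
  MidPos? : Decidable MidPos
  MidPos? = ⟦⟧? (+ 1) (M - + 1)
  MidNeg? : Decidable MidNeg
  MidNeg? = ⟦⟧? (- (m - + 1)) (- + 1)
  LargeNeg? : Decidable LargeNeg
  LargeNeg? = ⟦⟧? (- (m - + 1)) (- (m - + 2))
  SmallNeg? : Decidable SmallNeg
  SmallNeg? = ⟦⟧? (- (m - + 3)) (- + 1)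

  M∈Pos : Pos M
  M∈Pos = ℤP.≤-trans (+≤+ (s≤s z≤n)) 4≤M , ℤP.≤-refl

  -m∈Neg : Neg (- m)
  -m∈Neg = ℤP.≤-refl , ℤP.neg-mono-≤ (ℤP.≤-trans (+≤+ (s≤s z≤n)) 4≤m)

  MidPos⇒Pos : MidPos x → Pos x
  MidPos⇒Pos = ⟦⟧-widen ℤP.≤-refl (ℤP.i-j≤i M (+ 1))

  MidNeg⇒Neg : MidNeg x → Neg x
  MidNeg⇒Neg = ⟦⟧-widen -m≤-[m-1] ℤP.≤-refl

  SmallNeg⇒MidNeg : SmallNeg x → MidNeg x
  SmallNeg⇒MidNeg = ⟦⟧-widen (ℤP.neg-mono-≤ (ℤP.+-monoʳ-≤ m (-≤- z≤n))) ℤP.≤-refl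

  LargeNeg⇒MidNeg : LargeNeg x → MidNeg x
  LargeNeg⇒MidNeg = ⟦⟧-widen ℤP.≤-refl -[m-2]≤-1

  Pos⇒¬MidNeg : Pos x → ¬ MidNeg x
  Pos⇒¬MidNeg pos mn = ⟦⟧-disjoint mn pos -<+

  Neg⇒¬MidPos : Neg x → ¬ MidPos x
  Neg⇒¬MidPos neg mp = ⟦⟧-disjoint neg mp -<+

  M∉MidPos : ¬ MidPos M
  M∉MidPos mp = ⟦⟧-disjoint mp ⟦⟧-refl (ℤP.i≤pred[j]⇒i<j (ℤP.≤-reflexive (ℤP.+-comm M (- + 1))))

  -m∉MidNeg : ¬ MidNeg (- m)
  -m∉MidNeg mn = ⟦⟧-disjoint ⟦⟧-refl mn (ℤP.suc[i]≤j⇒i<j (ℤP.≤-reflexive (1+-x≡-[x-1] m)))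

  LargeNeg⇒¬SmallNeg : LargeNeg x → ¬ SmallNeg x
  LargeNeg⇒¬SmallNeg large small = ⟦⟧-disjoint large small (ℤP.suc[i]≤j⇒i<j (ℤP.≤-reflexive (1+-[x-2]≡-[x-3] m)))

  pos-cases : Pos x → x ≡ M ⊎ MidPos x
  pos-cases pos with ⟦⟧-split (M - + 1) pos
  ... | inj₁ mid = inj₂ mid
  ... | inj₂ top = inj₁ (⟦⟧-point (⟦⟧-widen (ℤP.≤-reflexive (sym (1+[x-1]≡x M))) ℤP.≤-refl top))

  neg-cases : Neg x → x ≡ - m ⊎ MidNeg x
  neg-cases neg with ⟦⟧-split (- m) neg
  ... | inj₁ bottom = inj₁ (⟦⟧-point bottom)
  ... | inj₂ mid = inj₂ (⟦⟧-widen (ℤP.≤-reflexive (sym (1+-x≡-[x-1] m))) ℤP.≤-refl mid)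

  midNeg-cases : MidNeg x → LargeNeg x ⊎ SmallNeg x
  midNeg-cases mn with ⟦⟧-split (- (m - + 2)) mn
  ... | inj₁ large = inj₁ large
  ... | inj₂ small = inj₂ (⟦⟧-widen (ℤP.≤-reflexive (sym (1+-[x-2]≡-[x-3] m))) ℤP.≤-refl small)

  largeNeg-cases : LargeNeg x → x ≡ - (m - + 1) ⊎ x ≡ - (m - + 2)
  largeNeg-cases large with ⟦⟧-split (- (m - + 1)) large
  ... | inj₁ bottom = inj₁ (⟦⟧-point bottom)
  ... | inj₂ top = inj₂ (⟦⟧-point (⟦⟧-widen (ℤP.≤-reflexive (sym (1+-[x-1]≡-[x-2] m))) ℤP.≤-refl top))

  midPos∉W : MidPos x → ¬ W x → x ≡ M - + 1
  midPos∉W mp ∉W with ⟦⟧-split (M - + 2) mp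
  ... | inj₁ low = ⊥-elim (∉W (⟦⟧-widen (ℤP.≤-trans -[m-2]≤0 (+≤+ z≤n)) ℤP.≤-refl low))
  ... | inj₂ top = ⟦⟧-point (⟦⟧-widen (ℤP.≤-reflexive (sym (1+[x-2]≡x-1 M))) ℤP.≤-refl top)

  midNeg∉W : MidNeg x → ¬ W x → x ≡ - (m - + 1)
  midNeg∉W mn ∉W with ⟦⟧-split (- (m - + 1)) mn
  ... | inj₁ bottom = ⟦⟧-point bottom
  ... | inj₂ high = ⊥-elim (∉W (⟦⟧-widen (ℤP.≤-reflexive (sym (1+-[x-1]≡-[x-2] m))) (ℤP.≤-trans -≤+ 0≤M-2) high))

  neg⇒SmallNeg : Neg x → x ≢ - m → ¬ LargeNeg x → SmallNeg x
  neg⇒SmallNeg neg x≢-m ¬large with neg-cases neg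
  ... | inj₁ x≡-m = ⊥-elim (x≢-m x≡-m)
  ... | inj₂ mn = [ ⊥-elim ∘ ¬large , id ]′ (midNeg-cases mn)

  mid-cases : ⟦ - m , M ⟧ x → x ≢ - m → x ≢ M → x ≢ + 0 → MidPos x ⊎ MidNeg x
  mid-cases x∈ x≢-m x≢M x≢0 with ⟦⟧-split (- + 1) x∈
  ... | inj₁ neg = inj₂ ([ ⊥-elim ∘ x≢-m , id ]′ (neg-cases neg))
  ... | inj₂ (0≤x , x≤M) =
    inj₁ ([ ⊥-elim ∘ x≢M , id ]′ (pos-cases (ℤP.i<j⇒suc[i]≤j (ℤP.≤∧≢⇒< 0≤x (x≢0 ∘ sym)) , x≤M)))

  W-below : ⟦ - (m - + 2) , - + 2 ⟧ c → Pos x → W (c + x)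
  W-below c∈ pos = ⟦⟧-widen (ℤP.i≤i+j _ (+ 1)) (ℤP.≤-reflexive (ℤP.+-comm (- + 2) M)) (⟦⟧-+ c∈ pos)

  W-above : ⟦ + 2 , M - + 2 ⟧ c → Neg x → W (c + x)
  W-above c∈ neg = ⟦⟧-widen (ℤP.≤-reflexive (sym (2+-x≡-[x-2] m))) (ℤP.i-j≤i (M - + 2) (+ 1)) (⟦⟧-+ c∈ neg)

  W-at-−1 : MidPos x → W (- + 1 + x)
  W-at-−1 mp = ⟦⟧-widen -[m-2]≤0 (ℤP.≤-reflexive (-1+[x-1]≡x-2 M)) (⟦⟧-+ (⟦⟧-refl { - + 1}) mp)

  W-at-−1-small : SmallNeg x → W (- + 1 + x)
  W-at-−1-small small =
    ⟦⟧-widen (ℤP.≤-reflexive (sym (-1+-[x-3]≡-[x-2] m))) (ℤP.≤-trans -≤+ 0≤M-2) (⟦⟧-+ (⟦⟧-refl { - + 1}) small)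

  W-at-+1 : MidNeg x → W (+ 1 + x)
  W-at-+1 mn = ⟦⟧-widen (ℤP.≤-reflexive (sym (1+-[x-1]≡-[x-2] m))) 0≤M-2 (⟦⟧-+ (⟦⟧-refl {+ 1}) mn)

  -- The terms already used are merged into their sum c, which keeps the sequence minimal.
  Base : ℤ → Vector ℤ k → Set
  Base c r = W c × IsMinimal (c ∷ r) × Over r

  Next : (∀ {k} → ℤ → Vector ℤ k → Set) → ℤ → Vector ℤ (suc k) → Set
  Next Inv c r = ∃ λ j → W (c + r j) × Inv (c + r j) (removeAt r j)

  module _ (Inv : ∀ {k} → ℤ → Vector ℤ k → Set)
           (step : ∀ {k c} (r : Vector ℤ (suc k)) → Base c r → Inv c r → Next Inv c r) where

    walk : ∀ {k c} (r : Vector ℤ k) → Base c r → Inv c r → Walk W c r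
    walk {zero} r _ _ = walk-[] r
    walk {suc k} r base@(_ , min , over) inv with step r base inv
    ... | j , w , inv′ = walk-∷ r j w (walk (removeAt r j) (w , IsMinimal-merge r min j , over ∘ punchIn j) inv′)

    walk-from : (s : Vector ℤ (suc k)) → IsMinimal s → Over s → ∀ j → W (s j) → Inv (s j) (removeAt s j) → Good W s
    walk-from s min over j w inv =
      walk-start s j w (walk (removeAt s j) (w , IsMinimal-moveToFront s min j , over ∘ punchIn j) inv)

  head-cases : (r : Vector ℤ (suc k)) → Base c r →
    ⟦ - (m - + 2) , - + 2 ⟧ c ⊎ c ≡ - + 1 ⊎ c ≡ + 1 ⊎ ⟦ + 2 , M - + 2 ⟧ c
  head-cases r ((lo , hi) , min , _)
    with nonzero-cases (IsMinimal⇒nonzero (_ ∷ r) min {zero} {suc zero} (λ ()) zero)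
  ... | inj₁ c≤-2 = inj₁ (lo , c≤-2)
  ... | inj₂ (inj₁ c≡-1) = inj₂ (inj₁ c≡-1)
  ... | inj₂ (inj₂ (inj₁ c≡1)) = inj₂ (inj₂ (inj₁ c≡1))
  ... | inj₂ (inj₂ (inj₂ 2≤c)) = inj₂ (inj₂ (inj₂ (2≤c , hi)))

  positive-term : (r : Vector ℤ k) → Base c r → c < + 0 → Any Pos r
  positive-term r (_ , min , over) c<0
    with ∃-pos r (subst (+ 0 <_) (sym (sum-tail≡-head r min)) (ℤP.neg-mono-< c<0))
  ... | j , 0<rj = j , ℤP.i<j⇒suc[i]≤j 0<rj , proj₂ (over j)

  negative-term : (r : Vector ℤ k) → Base c r → + 0 < c → Any Neg r
  negative-term r (_ , min , over) 0<c
    with ∃-neg r (subst (_< + 0) (sym (sum-tail≡-head r min)) (ℤP.neg-mono-< 0<c))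
  ... | j , rj<0 = j , proj₁ (over j) , ℤP.i<j⇒i≤pred[j] rj<0

  -- A later visit to v can be served: there is none, a P-term is kept for it, or no Q-term is left, which at v
  -- forces a P-term to exist or the visit to be impossible.
  data Ready (v : ℤ) (P Q : ℤ → Set) (c : ℤ) (r : Vector ℤ k) : Set where
    avoided : Avoids v c r → Ready v P Q c r
    reserved : Any P r → Ready v P Q c r
    unblocked : All (λ x → ¬ Q x) r → Ready v P Q c r

  Ready-removeAt : (r : Vector ℤ (suc k)) → ∀ {j} → ¬ P (r j) → Ready v P Q c r → Ready v P Q (c + r j) (removeAt r j)
  Ready-removeAt {c = c} r {j} _ (avoided avoids) = avoided (Avoids-removeAt {c = c} r avoids j)
  Ready-removeAt {P = P} r ¬pj (reserved any) = reserved (Any-removeAt-¬ {P = P} r any ¬pj)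
  Ready-removeAt r {j} _ (unblocked none) = unblocked (none ∘ punchIn j)

  Ready-at : (r : Vector ℤ k) → Ready v P Q v r → Any P r ⊎ All (λ x → ¬ Q x) r
  Ready-at r (avoided avoids) = ⊥-elim (Avoids⇒≢ r avoids refl)
  Ready-at r (reserved any) = inj₁ any
  Ready-at r (unblocked none) = inj₂ none

  midPos-at-−1 : (r : Vector ℤ k) → Base (- + 1) r → Ready (- + 1) MidPos (_≡ M) (- + 1) r → Any MidPos r
  midPos-at-−1 r base ready with Ready-at r ready
  ... | inj₁ found = found
  ... | inj₂ no-M with positive-term r base -<+
  ...   | j , pos = j , [ ⊥-elim ∘ no-M j , id ]′ (pos-cases pos)

  midNeg-at-+1 : (r : Vector ℤ k) → Base (+ 1) r → Ready (+ 1) MidNeg (_≡ - m) (+ 1) r → Any MidNeg r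
  midNeg-at-+1 r base ready with Ready-at r ready
  ... | inj₁ found = found
  ... | inj₂ no-m with negative-term r base (+<+ (s≤s z≤n))
  ...   | j , neg = j , [ ⊥-elim ∘ no-m j , id ]′ (neg-cases neg)

  Balanced : ℤ → Vector ℤ k → Set
  Balanced c r = Ready (- + 1) MidPos (_≡ M) c r × Ready (+ 1) MidNeg (_≡ - m) c r

  -- Below −1 a term M is preferred, and above +1 a term −m, so that the middle terms stay in reserve for ∓1.
  balanced-below : (r : Vector ℤ (suc k)) → Base c r → ⟦ - (m - + 2) , - + 2 ⟧ c → Balanced c r → Next Balanced c r
  balanced-below r base c∈ (ready₋ , ready₊) with any (ℤP._≟ M) r
  ... | yes (j , rj≡M) = j , W-below c∈ pos ,
    Ready-removeAt r (M∉MidPos ∘ subst MidPos rj≡M) ready₋ , Ready-removeAt r (Pos⇒¬MidNeg pos) ready₊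
    where pos = subst Pos (sym rj≡M) M∈Pos
  ... | no no-M with positive-term r base (ℤP.≤-<-trans (proj₂ c∈) -<+)
  ...   | j , pos = j , W-below c∈ pos ,
    unblocked (¬Any-removeAt {P = _≡ M} r no-M j) , Ready-removeAt r (Pos⇒¬MidNeg pos) ready₊

  balanced-above : (r : Vector ℤ (suc k)) → Base c r → ⟦ + 2 , M - + 2 ⟧ c → Balanced c r → Next Balanced c r
  balanced-above r base c∈ (ready₋ , ready₊) with any (ℤP._≟ - m) r
  ... | yes (j , rj≡-m) = j , W-above c∈ neg ,
    Ready-removeAt r (Neg⇒¬MidPos neg) ready₋ , Ready-removeAt r (-m∉MidNeg ∘ subst MidNeg rj≡-m) ready₊
    where neg = subst Neg (sym rj≡-m) -m∈Neg
  ... | no no-m with negative-term r base (ℤP.<-≤-trans (+<+ (s≤s z≤n)) (proj₁ c∈))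
  ...   | j , neg = j , W-above c∈ neg ,
    Ready-removeAt r (Neg⇒¬MidPos neg) ready₋ , unblocked (¬Any-removeAt {P = _≡ - m} r no-m j)

  balanced-at-−1 : (r : Vector ℤ (suc k)) → Base (- + 1) r → Balanced (- + 1) r → Next Balanced (- + 1) r
  balanced-at-−1 r base@(_ , min , _) (ready₋ , ready₊) with midPos-at-−1 r base ready₋
  ... | j , mp = j , W-at-−1 mp ,
    avoided (IsMinimal⇒Avoids r min j) , Ready-removeAt r (Pos⇒¬MidNeg (MidPos⇒Pos mp)) ready₊

  balanced-at-+1 : (r : Vector ℤ (suc k)) → Base (+ 1) r → Balanced (+ 1) r → Next Balanced (+ 1) r
  balanced-at-+1 r base@(_ , min , _) (ready₋ , ready₊) with midNeg-at-+1 r base ready₊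
  ... | j , mn = j , W-at-+1 mn ,
    Ready-removeAt r (Neg⇒¬MidPos (MidNeg⇒Neg mn)) ready₋ , avoided (IsMinimal⇒Avoids r min j)

  balanced-step : ∀ {k c} (r : Vector ℤ (suc k)) → Base c r → Balanced c r → Next Balanced c r
  balanced-step r base with head-cases r base
  ... | inj₁ c∈ = balanced-below r base c∈
  ... | inj₂ (inj₁ refl) = balanced-at-−1 r base
  ... | inj₂ (inj₂ (inj₁ refl)) = balanced-at-+1 r base
  ... | inj₂ (inj₂ (inj₂ c∈)) = balanced-above r base c∈

  -- A visit to +1 takes a middle negative term and a visit to −1 a small one; whichever comes first must leave
  -- what the other needs.
  data Spare (c : ℤ) (r : Vector ℤ k) : Set where
    avoided₋ : Avoids (- + 1) c r → Spare c r
    avoided₊ : Avoids (+ 1) c r → Spare c r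
    reserved₂ : Two MidNeg SmallNeg r → Spare c r
    exhausted : All (_≢ - m) r → Spare c r

  Spare-removeAt : (r : Vector ℤ (suc k)) → ∀ {j} → ¬ MidNeg (r j) → Spare c r → Spare (c + r j) (removeAt r j)
  Spare-removeAt {c = c} r {j} _ (avoided₋ avoids) = avoided₋ (Avoids-removeAt {c = c} r avoids j)
  Spare-removeAt {c = c} r {j} _ (avoided₊ avoids) = avoided₊ (Avoids-removeAt {c = c} r avoids j)
  Spare-removeAt r ¬mn (reserved₂ two) =
    reserved₂ (Two-removeAt-¬ {P = MidNeg} {Q = SmallNeg} r two ¬mn (¬mn ∘ SmallNeg⇒MidNeg))
  Spare-removeAt r {j} _ (exhausted none) = exhausted (none ∘ punchIn j)

  Lopsided : ℤ → Vector ℤ k → Set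
  Lopsided c r =
    All (λ x → ¬ MidPos x) r × Ready (- + 1) SmallNeg Neg c r × Ready (+ 1) MidNeg (_≡ - m) c r × Spare c r

  lopsided-below : (r : Vector ℤ (suc k)) → Base c r → ⟦ - (m - + 2) , - + 2 ⟧ c → Lopsided c r → Next Lopsided c r
  lopsided-below r base c∈ (no-mp , ready₋ , ready₊ , spare)
    with positive-term r base (ℤP.≤-<-trans (proj₂ c∈) -<+)
  ... | j , pos = j , W-below c∈ pos , no-mp ∘ punchIn j , Ready-removeAt r (¬mn ∘ SmallNeg⇒MidNeg) ready₋ ,
    Ready-removeAt r ¬mn ready₊ , Spare-removeAt r ¬mn spare
    where ¬mn = Pos⇒¬MidNeg pos

  -- Above +1, −m is preferred and then a large negative term, so that small negative terms stay in reserve.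
  lopsided-above : (r : Vector ℤ (suc k)) → Base c r → ⟦ + 2 , M - + 2 ⟧ c → Lopsided c r → Next Lopsided c r
  lopsided-above r base c∈ (no-mp , ready₋ , ready₊ , spare) with any (ℤP._≟ - m) r
  ... | yes (j , rj≡-m) = j , W-above c∈ (subst Neg (sym rj≡-m) -m∈Neg) , no-mp ∘ punchIn j ,
    Ready-removeAt r (¬mn ∘ SmallNeg⇒MidNeg) ready₋ , Ready-removeAt r ¬mn ready₊ , Spare-removeAt r ¬mn spare
    where ¬mn = -m∉MidNeg ∘ subst MidNeg rj≡-m
  ... | no no-m with any LargeNeg? r | ¬Any-removeAt {P = _≡ - m} r no-m
  ...   | yes (j , large) | no-m′ = j , W-above c∈ (MidNeg⇒Neg (LargeNeg⇒MidNeg large)) , no-mp ∘ punchIn j ,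
    Ready-removeAt r (LargeNeg⇒¬SmallNeg large) ready₋ , unblocked (no-m′ j) , exhausted (no-m′ j)
  ...   | no no-large | no-m′ with negative-term r base (ℤP.<-≤-trans (+<+ (s≤s z≤n)) (proj₁ c∈))
  ...     | j , neg = j , W-above c∈ neg , no-mp ∘ punchIn j ,
    [ reserved , unblocked ]′ (any-or-none {P = Neg} SmallNeg? (removeAt r j) λ x neg′ →
      neg⇒SmallNeg neg′ (no-m′ j x) (¬Any-removeAt {P = LargeNeg} r no-large j x)) ,
    unblocked (no-m′ j) , exhausted (no-m′ j)

  -- All remaining terms would be nonnegative, so a positive one is at most their sum 1, hence a middle positive.
  −1-needs-MidPos-or-Neg : (r : Vector ℤ (suc k)) → Base (- + 1) r →
    All (λ x → ¬ MidPos x) r → All (λ x → ¬ Neg x) r → ⊥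
  −1-needs-MidPos-or-Neg r base@(_ , min , over) no-mp no-neg with positive-term r base -<+
  ... | j , 1≤rj , _ = no-mp j (1≤rj , ℤP.≤-trans rj≤1 1≤M-1)
    where
    nonneg : All (λ x → + 0 ≤ x) r
    nonneg x with ⟦⟧-split (- + 1) (over x)
    ... | inj₁ neg = ⊥-elim (no-neg x neg)
    ... | inj₂ (0≤rx , _) = 0≤rx
    rj≤1 : r j ≤ + 1
    rj≤1 = subst (r j ≤_) (sum-tail≡-head r min) (term≤sum r nonneg j)

  lopsided-at-−1 : (r : Vector ℤ (suc k)) → Base (- + 1) r → Lopsided (- + 1) r → Next Lopsided (- + 1) r
  lopsided-at-−1 r base@(_ , min , _) (no-mp , ready₋ , ready₊ , spare) with Ready-at r ready₋
  ... | inj₂ no-neg = ⊥-elim (−1-needs-MidPos-or-Neg r base no-mp no-neg)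
  ... | inj₁ (j , small) =
    j , W-at-−1-small small , no-mp ∘ punchIn j , avoided leave , ready₊′ spare , avoided₋ leave
    where
    leave = IsMinimal⇒Avoids r min j
    ready₊′ : Spare (- + 1) r → Ready (+ 1) MidNeg (_≡ - m) (- + 1 + r j) (removeAt r j)
    ready₊′ (avoided₋ avoids) = ⊥-elim (Avoids⇒≢ r avoids refl)
    ready₊′ (avoided₊ avoids) = avoided (Avoids-removeAt {c = - + 1} r avoids j)
    ready₊′ (reserved₂ two) =
      reserved ([ id , (λ (x , sm) → x , SmallNeg⇒MidNeg sm) ]′
        (Two⇒Any-removeAt {P = MidNeg} {Q = SmallNeg} r two j))
    ready₊′ (exhausted none) = unblocked (none ∘ punchIn j)

  lopsided-at-+1 : (r : Vector ℤ (suc k)) → Base (+ 1) r → Lopsided (+ 1) r → Next Lopsided (+ 1) r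
  lopsided-at-+1 r base@(_ , min , _) (no-mp , ready₋ , ready₊ , spare) with any LargeNeg? r
  ... | yes (j , large) = j , W-at-+1 (LargeNeg⇒MidNeg large) , no-mp ∘ punchIn j ,
    Ready-removeAt r (LargeNeg⇒¬SmallNeg large) ready₋ , avoided leave , avoided₊ leave
    where leave = IsMinimal⇒Avoids r min j
  ... | no no-large with midNeg-at-+1 r base ready₊
  ...   | j , mn = j , W-at-+1 mn , no-mp ∘ punchIn j , ready₋′ spare , avoided leave , avoided₊ leave
    where
    leave = IsMinimal⇒Avoids r min j
    small : ∀ x → MidNeg (removeAt r j x) → SmallNeg (removeAt r j x)
    small x mn′ = [ ⊥-elim ∘ ¬Any-removeAt {P = LargeNeg} r no-large j x , id ]′ (midNeg-cases mn′)
    ready₋′ : Spare (+ 1) r → Ready (- + 1) SmallNeg Neg (+ 1 + r j) (removeAt r j)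
    ready₋′ (avoided₋ avoids) = avoided (Avoids-removeAt {c = + 1} r avoids j)
    ready₋′ (avoided₊ avoids) = ⊥-elim (Avoids⇒≢ r avoids refl)
    ready₋′ (reserved₂ two) =
      reserved ([ (λ (x , mn′) → x , small x mn′) , id ]′
        (Two⇒Any-removeAt {P = MidNeg} {Q = SmallNeg} r two j))
    ready₋′ (exhausted none) =
      [ reserved , unblocked ]′ (any-or-none {P = Neg} SmallNeg? (removeAt r j) λ x neg →
      neg⇒SmallNeg neg (none (punchIn j x)) (¬Any-removeAt {P = LargeNeg} r no-large j x))

  lopsided-step : ∀ {k c} (r : Vector ℤ (suc k)) → Base c r → Lopsided c r → Next Lopsided c r
  lopsided-step r base with head-cases r base
  ... | inj₁ c∈ = lopsided-below r base c∈
  ... | inj₂ (inj₁ refl) = lopsided-at-−1 r base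
  ... | inj₂ (inj₂ (inj₁ refl)) = lopsided-at-+1 r base
  ... | inj₂ (inj₂ (inj₂ c∈)) = lopsided-above r base c∈

  Mid : ℤ → Set
  Mid x = x ≢ - m × x ≢ M

  AllMid : (ℤ → Set) → Vector ℤ k → Set
  AllMid P s = ∀ i → s i ≢ - m → s i ≢ M → P (s i)

  AllMidExcept : Fin k → (ℤ → Set) → Vector ℤ k → Set
  AllMidExcept j P s = ∀ i → s i ≢ - m → s i ≢ M → i ≢ j → P (s i)

  Outcome : Vector ℤ k → Set
  Outcome s = Good W s
    ⊎ AllMid (λ x → x ≡ - (m - + 1) ⊎ x ≡ - (m - + 2)) s
    ⊎ AllMid (λ x → x ≡ M - + 1 ⊎ x ≡ - (m - + 1)) s
    ⊎ ∃ λ j → AllMidExcept j (_≡ - (m - + 1)) s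

  module _ (s : Vector ℤ (suc k)) (min : IsMinimal s) (over : Over s) (nonzero : All (_≢ + 0) s) where

    mid : ∀ i → s i ≢ - m → s i ≢ M → MidPos (s i) ⊎ MidNeg (s i)
    mid i s≢-m s≢M = mid-cases (over i) s≢-m s≢M (nonzero i)

    midNeg : All (λ x → ¬ MidPos x) s → ∀ i → s i ≢ - m → s i ≢ M → MidNeg (s i)
    midNeg no-mp i s≢-m s≢M = [ ⊥-elim ∘ no-mp i , id ]′ (mid i s≢-m s≢M)

    lopsided-outcome : All (λ x → ¬ MidPos x) s → Three Mid s → Outcome s
    lopsided-outcome no-mp three with any SmallNeg? s
    ... | no no-small = inj₂ (inj₁ λ i s≢-m s≢M →
      largeNeg-cases ([ id , ⊥-elim ∘ no-small ∘ (i ,_) ]′ (midNeg-cases (midNeg no-mp i s≢-m s≢M))))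
    ... | yes (j₁ , small₁) with FinP.any? (λ x → ¬? (x FinP.≟ j₁) ×-dec (MidNeg? (s x) ×-dec W? (s x)))
    ...   | no none = inj₂ (inj₂ (inj₂ (j₁ , λ i s≢-m s≢M i≢j₁ →
      midNeg∉W (midNeg no-mp i s≢-m s≢M) λ w → none (i , i≢j₁ , midNeg no-mp i s≢-m s≢M , w))))
    ...   | yes (j₂ , j₂≢j₁ , _ , w₂) with Three⇒avoiding {P = Mid} {s = s} three j₁ j₂
    ...     | x , x≢j₁ , x≢j₂ , s≢-m , s≢M = inj₁ (walk-from Lopsided lopsided-step s min over j₂ w₂
      (no-mp ∘ punchIn j₂ , reserved (Any-removeAt {P = SmallNeg} s small₁ j₂≢j₁) ,
       reserved (Any-removeAt {P = MidNeg} s (SmallNeg⇒MidNeg small₁) j₂≢j₁) ,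
       reserved₂ (Two-removeAt {P = MidNeg} {Q = SmallNeg} s x≢j₁ (midNeg no-mp x s≢-m s≢M) small₁ (x≢j₂ ∘ sym) j₂≢j₁)))

    balanced-outcome : ∀ jₚ → MidPos (s jₚ) → Two MidNeg MidNeg s → Outcome s
    balanced-outcome jₚ mpₚ two-neg@(x₋ , _ , _ , mn₋ , _) with FinP.any? (λ x → MidNeg? (s x) ×-dec W? (s x))
    ... | yes (j , mn , w) = inj₁ (walk-from Balanced balanced-step s min over j w
      (reserved (Any-removeAt {P = MidPos} s mpₚ λ j≡jₚ → Pos⇒¬MidNeg (MidPos⇒Pos mpₚ) (subst (MidNeg ∘ s) j≡jₚ mn)) ,
       reserved (reduce (Two⇒Any-removeAt {P = MidNeg} {Q = MidNeg} s two-neg j))))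
    ... | no no-neg-in-W with Two? MidPos? MidPos? s
    ...   | no ¬two-pos = inj₂ (inj₂ (inj₂ (jₚ , λ i s≢-m s≢M i≢jₚ →
      [ (λ mp → ⊥-elim (¬two-pos (i , jₚ , i≢jₚ , mp , mpₚ)))
      , (λ mn → midNeg∉W mn λ w → no-neg-in-W (i , mn , w)) ]′
        (mid i s≢-m s≢M))))
    ...   | yes two-pos with FinP.any? (λ x → MidPos? (s x) ×-dec W? (s x))
    ...     | yes (j , mp , w) = inj₁ (walk-from Balanced balanced-step s min over j w
      (reserved (reduce (Two⇒Any-removeAt {P = MidPos} {Q = MidPos} s two-pos j)) ,
       reserved (Any-removeAt {P = MidNeg} s mn₋ λ j≡x₋ →
         Pos⇒¬MidNeg (MidPos⇒Pos mp) (subst (MidNeg ∘ s) (sym j≡x₋) mn₋))))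
    ...     | no no-pos-in-W = inj₂ (inj₂ (inj₁ λ i s≢-m s≢M →
      [ (λ mp → inj₁ (midPos∉W mp λ w → no-pos-in-W (i , mp , w)))
      , (λ mn → inj₂ (midNeg∉W mn λ w → no-neg-in-W (i , mn , w))) ]′
        (mid i s≢-m s≢M)))

  one-sided-outcome : (s : Vector ℤ (suc k)) → IsMinimal s → Over s → Three Mid s → Two MidNeg MidNeg s → Outcome s
  one-sided-outcome s min over three@(i , j , _ , i≢j , _) two-neg with any MidPos? s
  ... | yes (jₚ , mpₚ) = balanced-outcome s min over nonzero jₚ mpₚ two-neg
    where nonzero = IsMinimal⇒nonzero s min i≢j
  ... | no no-mp = lopsided-outcome s min over nonzero (λ x → no-mp ∘ (x ,_)) three
    where nonzero = IsMinimal⇒nonzero s min i≢j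

Classified : (m M : ℤ) → Vector ℤ n → Set
Classified {n} m M s =
  Σ (Permutation′ n) λ σ →
         (∀ k → 1 ℕ.≤ k → k ℕ.≤ n →
            ⟦ - (m - + 1) , M - + 3 ⟧ (prefixSum n (λ i → s (σ ⟨$⟩ʳ i)) k))
       ⊎ (∀ k → 1 ℕ.≤ k → k ℕ.≤ n →
            ⟦ - (m - + 2) , M - + 2 ⟧ (prefixSum n (λ i → s (σ ⟨$⟩ʳ i)) k))
       ⊎ (∀ k → 1 ℕ.≤ k → k ℕ.≤ n →
            ⟦ - (m - + 3) , M - + 1 ⟧ (prefixSum n (λ i → s (σ ⟨$⟩ʳ i)) k))
       ⊎ ((∀ i → s i ≢ - m → s i ≢ M → s i ≡ M - + 1 ⊎ s i ≡ M - + 2)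
          ⊎ (∀ i → s i ≢ - m → s i ≢ M → s i ≡ - (m - + 1) ⊎ s i ≡ - (m - + 2)))
       ⊎ (∀ i → s i ≢ - m → s i ≢ M → s i ≡ M - + 1 ⊎ s i ≡ - (m - + 1))
       ⊎ ((∃ λ j → ∀ i → s i ≢ - m → s i ≢ M → i ≢ j → s i ≡ M - + 1)
          ⊎ (∃ λ j → ∀ i → s i ≢ - m → s i ≢ M → i ≢ j → s i ≡ - (m - + 1)))

x≢y⇒-x≢-y : x ≢ y → - x ≢ - y
x≢y⇒-x≢-y x≢y = x≢y ∘ ℤP.neg-injective

-x≡y⇒x≡-y : - x ≡ y → x ≡ - y
-x≡y⇒x≡-y {x} -x≡y = trans (sym (ℤP.neg-involutive x)) (cong -_ -x≡y)

x≢-y⇒-x≢y : x ≢ - y → - x ≢ y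
x≢-y⇒-x≢y x≢-y = x≢-y ∘ -x≡y⇒x≡-y

module _ (m M : ℤ) (4≤m : + 4 ≤ m) (4≤M : + 4 ≤ M) where

  open Window m M 4≤m 4≤M
  private module Mirror = Window M m 4≤M 4≤m

  Outcome⇒Classified : (s : Vector ℤ n) → Outcome s → Classified m M s
  Outcome⇒Classified s (inj₁ (σ , σ-ok)) = σ , inj₂ (inj₁ σ-ok)
  Outcome⇒Classified s (inj₂ (inj₁ near-−m)) = Perm.id , inj₂ (inj₂ (inj₂ (inj₁ (inj₂ near-−m))))
  Outcome⇒Classified s (inj₂ (inj₂ (inj₁ extreme))) = Perm.id , inj₂ (inj₂ (inj₂ (inj₂ (inj₁ extreme))))
  Outcome⇒Classified s (inj₂ (inj₂ (inj₂ all-but-one))) =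
    Perm.id , inj₂ (inj₂ (inj₂ (inj₂ (inj₂ (inj₂ all-but-one)))))

  mirrored-Outcome⇒Classified : (s : Vector ℤ n) → Mirror.Outcome (-_ ∘ s) → Classified m M s
  mirrored-Outcome⇒Classified {n} s (inj₁ (σ , σ-ok)) = σ , inj₂ (inj₁ λ K 1≤K K≤n →
    ⟦⟧-neg⁻ (subst Mirror.W (prefixSum-neg n (s ∘ (σ ⟨$⟩ʳ_)) K) (σ-ok K 1≤K K≤n)))
  mirrored-Outcome⇒Classified s (inj₂ (inj₁ near-M)) = Perm.id , inj₂ (inj₂ (inj₂ (inj₁ (inj₁ λ i s≢-m s≢M →
    Sum.map ℤP.neg-injective ℤP.neg-injective (near-M i (x≢y⇒-x≢-y s≢M) (x≢-y⇒-x≢y s≢-m))))))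
  mirrored-Outcome⇒Classified s (inj₂ (inj₂ (inj₁ extreme))) = Perm.id , inj₂ (inj₂ (inj₂ (inj₂ (inj₁ λ i s≢-m s≢M →
    [ inj₂ ∘ -x≡y⇒x≡-y , inj₁ ∘ ℤP.neg-injective ]′ (extreme i (x≢y⇒-x≢-y s≢M) (x≢-y⇒-x≢y s≢-m))))))
  mirrored-Outcome⇒Classified s (inj₂ (inj₂ (inj₂ (j , all-but-j)))) = Perm.id , inj₂ (inj₂ (inj₂ (inj₂ (inj₂ (inj₁ (j ,
    λ i s≢-m s≢M i≢j → ℤP.neg-injective (all-but-j i (x≢y⇒-x≢-y s≢M) (x≢-y⇒-x≢y s≢-m) i≢j)))))))

  classify : (s : Vector ℤ (suc n)) → IsMinimal s → Over s → Three Mid s → Classified m M s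
  classify s min over three@(i , j , _ , i≢j , _)
    with Three⇒Two {P = MidPos} {Q = MidNeg} (Three-map {P = Mid} {Q = λ x → MidPos x ⊎ MidNeg x} {t = s} mid′ three)
    where
    mid′ : ∀ x → Mid (s x) → MidPos (s x) ⊎ MidNeg (s x)
    mid′ x (s≢-m , s≢M) = mid-cases (over x) s≢-m s≢M (IsMinimal⇒nonzero s min i≢j x)
  ... | inj₂ two-neg = Outcome⇒Classified s (one-sided-outcome s min over three two-neg)
  ... | inj₁ (x , y , x≢y , mp , mp′) = mirrored-Outcome⇒Classified s (Mirror.one-sided-outcome (-_ ∘ s)
    (IsMinimal-neg s min)
    (λ z → subst (λ u → ⟦ - M , u ⟧ (- s z)) (ℤP.neg-involutive m) (⟦⟧-neg (over z)))
    (Three-map {P = Mid} {Q = Mirror.Mid} (λ _ (s≢-m , s≢M) → x≢y⇒-x≢-y s≢M , x≢-y⇒-x≢y s≢-m) three)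
    (x , y , x≢y , ⟦⟧-neg mp , ⟦⟧-neg mp′))

window-width : ∀ m M i → M - (+ 4 - i) - - (m - i) + + 1 ≡ m + M - + 3
window-width = solve-∀

lemma3p12 : (m M : ℤ) → + 4 ≤ m → + 4 ≤ M →
    (n : ℕ) → (s : Fin n → ℤ) →
    IsMinimalZeroSum n s →
    IsOver n s ⟦ - m , M ⟧ →
    (∃ λ i → ∃ λ j → ∃ λ k → i ≢ j × i ≢ k × j ≢ k ×
       (s i ≢ - m × s i ≢ M) × (s j ≢ - m × s j ≢ M) × (s k ≢ - m × s k ≢ M)) →
    (Σ (Permutation′ n) λ σ →
         (∀ k → 1 ℕ.≤ k → k ℕ.≤ n →
            ⟦ - (m - + 1) , M - + 3 ⟧ (prefixSum n (λ i → s (σ ⟨$⟩ʳ i)) k))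
       ⊎ (∀ k → 1 ℕ.≤ k → k ℕ.≤ n →
            ⟦ - (m - + 2) , M - + 2 ⟧ (prefixSum n (λ i → s (σ ⟨$⟩ʳ i)) k))
       ⊎ (∀ k → 1 ℕ.≤ k → k ℕ.≤ n →
            ⟦ - (m - + 3) , M - + 1 ⟧ (prefixSum n (λ i → s (σ ⟨$⟩ʳ i)) k))
       ⊎ ((∀ i → s i ≢ - m → s i ≢ M → s i ≡ M - + 1 ⊎ s i ≡ M - + 2)
          ⊎ (∀ i → s i ≢ - m → s i ≢ M → s i ≡ - (m - + 1) ⊎ s i ≡ - (m - + 2)))
       ⊎ (∀ i → s i ≢ - m → s i ≢ M → s i ≡ M - + 1 ⊎ s i ≡ - (m - + 1))
       ⊎ ((∃ λ j → ∀ i → s i ≢ - m → s i ≢ M → i ≢ j → s i ≡ M - + 1)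
          ⊎ (∃ λ j → ∀ i → s i ≢ - m → s i ≢ M → i ≢ j → s i ≡ - (m - + 1))))
    × (∀ (σ : Permutation′ n) →
         (∀ k → 1 ℕ.≤ k → k ℕ.≤ n →
            ⟦ - (m - + 1) , M - + 3 ⟧ (prefixSum n (λ i → s (σ ⟨$⟩ʳ i)) k))
       ⊎ (∀ k → 1 ℕ.≤ k → k ℕ.≤ n →
            ⟦ - (m - + 2) , M - + 2 ⟧ (prefixSum n (λ i → s (σ ⟨$⟩ʳ i)) k))
       ⊎ (∀ k → 1 ℕ.≤ k → k ℕ.≤ n →
            ⟦ - (m - + 3) , M - + 1 ⟧ (prefixSum n (λ i → s (σ ⟨$⟩ʳ i)) k))
       → + n ≤ m + M - + 3)
lemma3p12 m M 4≤m 4≤M zero s _ _ (() , _)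
lemma3p12 m M 4≤m 4≤M (suc n) s zero-sum over three =
  classify m M 4≤m 4≤M s min over three ,
  λ σ → [ width-bound σ (+ 1) , [ width-bound σ (+ 2) , width-bound σ (+ 3) ]′ ]′
  where
  min = isMinimalZeroSum⇒IsMinimal (suc n) s zero-sum
  width-bound : ∀ σ i → (∀ K → 1 ℕ.≤ K → K ℕ.≤ suc n →
    ⟦ - (m - i) , M - (+ 4 - i) ⟧ (prefixSum (suc n) (s ∘ (σ ⟨$⟩ʳ_)) K)) → + suc n ≤ m + M - + 3
  width-bound σ i window = subst (λ w → + suc n ≤ w) (window-width m M i)
    (window⇒length≤ (s ∘ (σ ⟨$⟩ʳ_)) (IsMinimal-permute s min σ) window)
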